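{- Let $\lambda\vdash n$ and let $T$ be a Richardson tableau of shape $\lambda$. Let the entries of the first row of $T$, read left to right, be $1=a_1<a_2<\cdots<a_{\lambda_1}$, and set $a_{\lambda_1+1}=n+1$. Then for each $1\le i\le\lambda_1$, the cells of $T$ occupied by the entries $\{a_i,a_i+1,\ldots,a_{i+1}-1\}$ form a column strip.
   Context: Young diagrams are in English notation. A standard Young tableau (SYT) of shape $\lambda\vdash n$ is a bijective filling with $[n]$ increasing along rows and down columns. A column strip is a skew shape with no two boxes in the same row. For an SYT $T$ of shape $\lambda$, $\operatorname{crop}(T)$ is the SYT of shape $(\lambda_2,\lambda_3,\ldots)$ obtained by deleting the first row and standardizing the remaining entries to $1,\ldots,|\lambda|-\lambda_1$ preserving relative order. An SYT $T$ is a Richardson tableau if (1) for every entry $j$ in the second row of $T$, $j-1$ lies in the first row, and (2) $\operatorname{crop}(T)$ is a Richardson tableau (the empty tableau being Richardson). -}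

module Defs where

open import Data.Nat using (ℕ; zero; suc; _≤_; _<_; _≤?_; _∸_)
open import Data.List using (List; []; _∷_; map; length; concat; filter; upTo)
open import Data.Nat.ListAction using (sum)
open import Data.Unit using (⊤)
open import Data.List.Relation.Unary.All using (All)
open import Data.List.Relation.Unary.Linked using (Linked)
open import Data.List.Relation.Binary.Permutation.Propositional using (_↭_)
open import Data.List.Membership.Propositional using (_∈_)
open import Data.Maybe using (Maybe; just; nothing)
open import Data.Product using (Σ; ∃; _×_)
open import Relation.Binary.PropositionalEquality using (_≡_)
open import Relation.Nullary using (¬_)
open import Function.Bundles using (_⇔_)

-- A tableau is given by its list of rows (top to bottom), each row read left to right.
Tableau : Set
Tableau = List (List ℕ)

IsPartition : List ℕ → Set
IsPartition λ′ = Linked (λ a b → b ≤ a) λ′ × All (λ a → 0 < a) λ′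

shape : Tableau → List ℕ
shape = map length

nth : {A : Set} → List A → ℕ → Maybe A
nth []       _       = nothing
nth (x ∷ xs) zero    = just x
nth (x ∷ xs) (suc i) = nth xs i

-- part r of a partition (0 beyond its length); rows indexed from 0
part : List ℕ → ℕ → ℕ
part []       _       = 0
part (x ∷ xs) zero    = x
part (x ∷ xs) (suc i) = part xs i

entryAt : Tableau → ℕ → ℕ → Maybe ℕ
entryAt []       _       c = nothing
entryAt (row ∷ T) zero    c = nth row c
entryAt (row ∷ T) (suc r) c = entryAt T r c

oneTo : ℕ → List ℕ
oneTo n = map suc (upTo n)

record IsSYT (λ′ : List ℕ) (n : ℕ) (T : Tableau) : Set where
  field
    shape-eq  : shape T ≡ λ′
    partition : IsPartition λ′
    size      : sum λ′ ≡ n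
    bijective : concat T ↭ oneTo n
    rows-inc  : All (Linked _<_) T
    cols-inc  : ∀ r c y → entryAt T (suc r) c ≡ just y →
                Σ ℕ (λ x → entryAt T r c ≡ just x × x < y)

rank : List ℕ → ℕ → ℕ
rank xs x = length (filter (λ y → y ≤? x) xs)

standardize : Tableau → Tableau
standardize T = map (map (rank (concat T))) T

crop : Tableau → Tableau
crop []      = []
crop (_ ∷ T) = standardize T

SecondRowCond : Tableau → Set
SecondRowCond (r₁ ∷ r₂ ∷ T) = ∀ j → j ∈ r₂ → (j ∸ 1) ∈ r₁
SecondRowCond _             = ⊤

data Richardson : Tableau → Set where
  rich-empty : Richardson []
  rich-cons  : ∀ r T → SecondRowCond (r ∷ T) → Richardson (crop (r ∷ T)) →
               Richardson (r ∷ T)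

firstRow : Tableau → List ℕ
firstRow []      = []
firstRow (r ∷ _) = r

-- a sequence with a_{k+1} = n+1 past the end (0-based: aSeq n T i = a_{i+1})
aSeq : ℕ → Tableau → ℕ → ℕ
aSeq n T i with nth (firstRow T) i
... | just a  = a
... | nothing = suc n

IsColumnStrip : (ℕ → ℕ → Set) → Set
IsColumnStrip S =
  Σ (List ℕ) λ μ → Σ (List ℕ) λ ν →
    IsPartition μ × IsPartition ν × (∀ r → part μ r ≤ part ν r) ×
    (∀ r c → S r c ⇔ (c < part ν r × ¬ (c < part μ r))) ×
    (∀ r c c′ → S r c → S r c′ → c ≡ c′)

cellsWithEntriesIn : Tableau → ℕ → ℕ → ℕ → ℕ → Set
cellsWithEntriesIn T lo hi r c = Σ ℕ λ e → entryAt T r c ≡ just e × lo ≤ e × e < hi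

module Submission where

open import Defs
open import Data.Nat using (ℕ; zero; suc; _<_; _≤_; z≤n; s≤s; _<?_; _≤?_; _⊔_; _∸_)
open import Data.Nat.Properties
open import Data.List using (List; []; _∷_; length; map; concat; _++_; filter)
open import Data.List.Properties using (concat-map; filter-accept; filter-reject)
open import Data.List.Relation.Unary.All as All using (All; []; _∷_)
open import Data.List.Relation.Unary.All.Properties using (all-filter; map⁺)
open import Data.List.Relation.Unary.Any using (here; there)
open import Data.List.Relation.Unary.Linked using (Linked; []; [-]; _∷_)
import Data.List.Relation.Unary.Linked.Properties as Linked
open import Data.List.Relation.Unary.Unique.Propositional using (Unique)
open import Data.List.Relation.Unary.AllPairs using ([]; _∷_)
import Data.List.Relation.Unary.Unique.Propositional.Properties as Unique
open import Data.List.Relation.Binary.Permutation.Propositional using (↭-sym; ↭⇒↭ₛ)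
open import Data.List.Relation.Binary.Permutation.Setoid.Properties
  using (Unique-resp-↭)
open import Data.List.Membership.Propositional using (_∈_; _∉_)
open import Data.List.Membership.Propositional.Properties using (∈-map⁺; ∈-map⁻; ∈-++⁺ˡ; ∈-++⁺ʳ)
open import Data.Maybe using (just)
open import Data.Product using (Σ; ∃-syntax; _×_; _,_)
open import Data.Sum using (inj₁; inj₂)
open import Data.Empty using (⊥; ⊥-elim)
open import Relation.Nullary using (¬_; yes; no)
open import Relation.Binary.Definitions using (tri<; tri≈; tri>)
open import Relation.Binary.PropositionalEquality
  using (_≡_; _≢_; refl; sym; trans; cong; subst; setoid; module ≡-Reasoning)
open import Function.Base using (case_of_)
open import Function.Bundles using (_⇔_; mk⇔)

-- Say that T separates its rows if any two entries u < v of a common row are split by a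
-- first-row entry x with u < x ≤ v. Richardson tableaux do: inductively the ranks of u and v
-- are split in the crop by the rank of a second-row entry w, so u < w ≤ v, and then w - 1 is a
-- first-row entry that cannot be u, as u lies in a lower row. In a tableau with increasing rows
-- and columns the cells with entries in [lo, hi) always form a skew shape ν/μ, where μ and ν
-- count the entries of each row below lo and hi. For lo = a_i and hi = a_{i+1} no first-row
-- entry lies strictly between lo and hi, so separation leaves at most one of these cells per row.

row : Tableau → ℕ → List ℕ
row []      _       = []
row (r ∷ T) zero    = r
row (r ∷ T) (suc i) = row T i

entryAt-row : ∀ T r c → entryAt T r c ≡ nth (row T r) c
entryAt-row []      r       c = refl
entryAt-row (_ ∷ T) zero    c = refl
entryAt-row (_ ∷ T) (suc r) c = entryAt-row T r c

entryAt⇒nth-row : ∀ T r c {e} → entryAt T r c ≡ just e → nth (row T r) c ≡ just e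
entryAt⇒nth-row T r c = trans (sym (entryAt-row T r c))

row-∈-concat : ∀ T r {u} → u ∈ row T r → u ∈ concat T
row-∈-concat (x ∷ T) zero    h = ∈-++⁺ˡ h
row-∈-concat (x ∷ T) (suc r) h = ∈-++⁺ʳ x (row-∈-concat T r h)

row-map : ∀ (f : ℕ → ℕ) T r → row (map (map f) T) r ≡ map f (row T r)
row-map f []      r       = refl
row-map f (_ ∷ T) zero    = refl
row-map f (_ ∷ T) (suc r) = row-map f T r

row-sorted : ∀ T r → All (Linked _<_) T → Linked _<_ (row T r)
row-sorted []      r       _        = []
row-sorted (_ ∷ T) zero    (l ∷ _)  = l
row-sorted (_ ∷ T) (suc r) (_ ∷ ls) = row-sorted T r ls

nth-∈ : ∀ {A : Set} (xs : List A) c {e} → nth xs c ≡ just e → e ∈ xs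
nth-∈ (x ∷ xs) zero    refl = here refl
nth-∈ (x ∷ xs) (suc c) h    = there (nth-∈ xs c h)

∈⇒nth : ∀ {A : Set} {xs : List A} {e} → e ∈ xs → ∃[ c ] nth xs c ≡ just e
∈⇒nth (here refl) = zero , refl
∈⇒nth (there h) with ∈⇒nth h
... | c , eq = suc c , eq

nth-<-length : ∀ {A : Set} (xs : List A) {i} → i < length xs → ∃[ a ] nth xs i ≡ just a
nth-<-length (x ∷ xs) {zero}  _         = x , refl
nth-<-length (x ∷ xs) {suc i} (s≤s i<n) = nth-<-length xs i<n

tail-sorted : ∀ {x : ℕ} {xs} → Linked _<_ (x ∷ xs) → Linked _<_ xs
tail-sorted [-]     = []
tail-sorted (_ ∷ l) = l

nth-head-< : ∀ {z} zs k {y} → Linked _<_ (z ∷ zs) → nth zs k ≡ just y → z < y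
nth-head-< (_ ∷ _)  zero    (z<y ∷ _) refl = z<y
nth-head-< (_ ∷ ys) (suc k) (z<y ∷ l) h    = <-trans z<y (nth-head-< ys k l h)

nth-strictMono : ∀ (xs : List ℕ) {j k x y} → Linked _<_ xs → j < k →
                 nth xs j ≡ just x → nth xs k ≡ just y → x < y
nth-strictMono (z ∷ zs) {zero}  {suc k} l _         refl h  = nth-head-< zs k l h
nth-strictMono (z ∷ zs) {suc j} {suc k} l (s≤s j<k) h    h′ =
  nth-strictMono zs (tail-sorted l) j<k h h′

nth-mono : ∀ (xs : List ℕ) {j k x y} → Linked _<_ xs → j ≤ k →
           nth xs j ≡ just x → nth xs k ≡ just y → x ≤ y
nth-mono xs l j≤k h h′ with m≤n⇒m<n∨m≡n j≤k
... | inj₁ j<k  = <⇒≤ (nth-strictMono xs l j<k h h′)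
... | inj₂ refl with trans (sym h) h′
... | refl = ≤-refl

nth-defined-≤ : ∀ {A : Set} (xs : List A) {j k y} → j ≤ k → nth xs k ≡ just y → ∃[ x ] nth xs j ≡ just x
nth-defined-≤ (x ∷ xs) {zero}          _         _ = x , refl
nth-defined-≤ (x ∷ xs) {suc j} {suc k} (s≤s j≤k) h = nth-defined-≤ xs j≤k h

rank-∷-≤ : ∀ L {z x} → z ≤ x → rank (z ∷ L) x ≡ suc (rank L x)
rank-∷-≤ L {x = x} z≤x = cong length (filter-accept (_≤? x) z≤x)

rank-∷-≰ : ∀ L {z x} → ¬ z ≤ x → rank (z ∷ L) x ≡ rank L x
rank-∷-≰ L {x = x} z≰x = cong length (filter-reject (_≤? x) z≰x)

rank-mono-≤ : ∀ L {x y} → x ≤ y → rank L x ≤ rank L y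
rank-mono-≤ []      _   = z≤n
rank-mono-≤ (z ∷ L) {x} {y} x≤y with z ≤? x | z ≤? y
... | yes z≤x | yes z≤y rewrite rank-∷-≤ L z≤x | rank-∷-≤ L z≤y = s≤s (rank-mono-≤ L x≤y)
... | yes z≤x | no  z≰y = ⊥-elim (z≰y (≤-trans z≤x x≤y))
... | no  z≰x | yes z≤y rewrite rank-∷-≰ L z≰x | rank-∷-≤ L z≤y = m≤n⇒m≤1+n (rank-mono-≤ L x≤y)
... | no  z≰x | no  z≰y rewrite rank-∷-≰ L z≰x | rank-∷-≰ L z≰y = rank-mono-≤ L x≤y

rank-mono-< : ∀ L {x y} → x < y → y ∈ L → rank L x < rank L y
rank-mono-< (z ∷ L) {x} {y} x<y y∈L with z ≤? x | z ≤? y | y∈L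
... | yes z≤x | _       | here refl = ⊥-elim (<⇒≱ x<y z≤x)
... | no  z≰x | yes z≤y | here refl rewrite rank-∷-≰ L z≰x | rank-∷-≤ L z≤y =
  s≤s (rank-mono-≤ L (<⇒≤ x<y))
... | no  _   | no  z≰y | here refl = ⊥-elim (z≰y ≤-refl)
... | yes z≤x | yes z≤y | there h rewrite rank-∷-≤ L z≤x | rank-∷-≤ L z≤y = s≤s (rank-mono-< L x<y h)
... | yes z≤x | no  z≰y | there _ = ⊥-elim (z≰y (≤-trans z≤x (<⇒≤ x<y)))
... | no  z≰x | yes z≤y | there h rewrite rank-∷-≰ L z≰x | rank-∷-≤ L z≤y =
  m≤n⇒m≤1+n (rank-mono-< L x<y h)
... | no  z≰x | no  z≰y | there h rewrite rank-∷-≰ L z≰x | rank-∷-≰ L z≰y = rank-mono-< L x<y h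

rank-cancel-< : ∀ L {x y} → rank L x < rank L y → x < y
rank-cancel-< L r< = ≰⇒> λ y≤x → <⇒≱ r< (rank-mono-≤ L y≤x)

rank-cancel-≤ : ∀ L {x y} → x ∈ L → rank L x ≤ rank L y → x ≤ y
rank-cancel-≤ L x∈L r≤ = ≮⇒≥ λ y<x → <⇒≱ (rank-mono-< L y<x x∈L) r≤

rank-injectiveOn : ∀ L {x y} → x ∈ L → y ∈ L → rank L x ≡ rank L y → x ≡ y
rank-injectiveOn L x∈L y∈L eq =
  ≤-antisym (rank-cancel-≤ L x∈L (≤-reflexive eq)) (rank-cancel-≤ L y∈L (≤-reflexive (sym eq)))

Unique-++⁻ : ∀ (xs : List ℕ) {ys} → Unique (xs ++ ys) → (∀ {u} → u ∈ xs → u ∉ ys) × Unique ys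
Unique-++⁻ []       u        = (λ ()) , u
Unique-++⁻ (x ∷ xs) (x∉ ∷ u) with Unique-++⁻ xs u
... | disjoint , uys = apart , uys
  where
  apart : ∀ {v} → v ∈ x ∷ xs → v ∉ _
  apart (here refl) v∈ys = All.lookup x∉ (∈-++⁺ʳ xs v∈ys) refl
  apart (there v∈xs)     = disjoint v∈xs

Unique-map⁺-on : ∀ (f : ℕ → ℕ) {xs} → (∀ {x y} → x ∈ xs → y ∈ xs → f x ≡ f y → x ≡ y) →
                 Unique xs → Unique (map f xs)
Unique-map⁺-on f          inj []       = []
Unique-map⁺-on f {x ∷ xs} inj (x∉ ∷ u) =
  map⁺ (All.tabulate λ y∈ fx≡fy → All.lookup x∉ y∈ (inj (here refl) (there y∈) fx≡fy)) ∷
  Unique-map⁺-on f (λ x∈ y∈ → inj (there x∈) (there y∈)) u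

standardize-unique : ∀ T → Unique (concat T) → Unique (concat (standardize T))
standardize-unique T u = subst Unique (sym (concat-map T))
  (Unique-map⁺-on (rank (concat T)) (rank-injectiveOn (concat T)) u)

FirstRowSeparates : Tableau → Set
FirstRowSeparates T = ∀ r {u v} → u ∈ row T r → v ∈ row T r → u < v →
  ∃[ x ] x ∈ firstRow T × u < x × x ≤ v

predecessor-between : ∀ {u v w} → u < w → w ≤ v → u ≢ w ∸ 1 → u < w ∸ 1 × w ∸ 1 ≤ v
predecessor-between {w = suc w} (s≤s u≤w) w<v u≢w = ≤∧≢⇒< u≤w u≢w , ≤-trans (n≤1+n w) w<v

∈-row-standardize : ∀ T r {y} → y ∈ row T r → rank (concat T) y ∈ row (standardize T) r
∈-row-standardize T r y∈ =
  subst (rank (concat T) _ ∈_) (sym (row-map (rank (concat T)) T r)) (∈-map⁺ (rank (concat T)) y∈)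

module _ (r₀ r₁ : List ℕ) (T : Tableau) where
  private
    L : List ℕ
    L = concat (r₁ ∷ T)

  separates-from-crop : SecondRowCond (r₀ ∷ r₁ ∷ T) → (∀ {u} → u ∈ r₀ → u ∉ L) →
    FirstRowSeparates (standardize (r₁ ∷ T)) →
    ∀ r {u v} → u ∈ row (r₁ ∷ T) r → v ∈ row (r₁ ∷ T) r → u < v → ∃[ x ] x ∈ r₀ × u < x × x ≤ v
  separates-from-crop secondRow r₀-apart cropSeparates r u∈ v∈ u<v
    with cropSeparates r (∈-row-standardize (r₁ ∷ T) r u∈) (∈-row-standardize (r₁ ∷ T) r v∈)
                       (rank-mono-< L u<v (row-∈-concat (r₁ ∷ T) r v∈))
  ... | x , x∈ , ru<x , x≤rv with ∈-map⁻ (rank L) x∈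
  ... | w , w∈r₁ , refl =
    w ∸ 1 , secondRow w w∈r₁ ,
    predecessor-between (rank-cancel-< L ru<x) (rank-cancel-≤ L (∈-++⁺ˡ w∈r₁) x≤rv)
      (λ { refl → r₀-apart (secondRow w w∈r₁) (row-∈-concat (r₁ ∷ T) r u∈) })

richardson-separates : ∀ T → Richardson T → Unique (concat T) → FirstRowSeparates T
richardson-separates (r₀ ∷ T) _ _ zero {v = v} _ v∈r₀ u<v = v , v∈r₀ , u<v , ≤-refl
richardson-separates (r₀ ∷ r₁ ∷ T) (rich-cons _ _ secondRow cropped) u (suc r)
  with Unique-++⁻ r₀ u
... | r₀-apart , uT = separates-from-crop r₀ r₁ T secondRow r₀-apart
  (richardson-separates (standardize (r₁ ∷ T)) cropped (standardize-unique (r₁ ∷ T) uT)) r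

countBelow : ℕ → List ℕ → ℕ
countBelow b []       = 0
countBelow b (z ∷ zs) with z <? b
... | yes _ = suc (countBelow b zs)
... | no  _ = countBelow b zs

countBelow-≮ : ∀ {z b} zs → Linked _<_ (z ∷ zs) → ¬ z < b → countBelow b zs ≡ 0
countBelow-≮         []       _           _   = refl
countBelow-≮ {b = b} (y ∷ ys) (z<y ∷ l) z≮b with y <? b
... | yes y<b = ⊥-elim (z≮b (<-trans z<y y<b))
... | no  y≮b = countBelow-≮ ys l y≮b

countBelow⁺ : ∀ b xs c {e} → Linked _<_ xs → nth xs c ≡ just e → e < b → c < countBelow b xs
countBelow⁺ b (z ∷ zs) c l h e<b with z <? b
countBelow⁺ b (z ∷ zs) zero    l h e<b | yes _ = s≤s z≤n
countBelow⁺ b (z ∷ zs) (suc c) l h e<b | yes _ = s≤s (countBelow⁺ b zs c (tail-sorted l) h e<b)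
... | no z≮b = ⊥-elim (z≮b (≤-<-trans (nth-mono (z ∷ zs) {k = c} l z≤n refl h) e<b))

countBelow⁻ : ∀ b xs c → Linked _<_ xs → c < countBelow b xs → ∃[ e ] nth xs c ≡ just e × e < b
countBelow⁻ b (z ∷ zs) c l c< with z <? b
countBelow⁻ b (z ∷ zs) zero    l _         | yes z<b = z , refl , z<b
countBelow⁻ b (z ∷ zs) (suc c) l (s≤s c<) | yes _   = countBelow⁻ b zs c (tail-sorted l) c<
... | no z≮b rewrite countBelow-≮ zs l z≮b = ⊥-elim (n≮0 c<)

≤-by-indices : ∀ m n → (∀ c → c < m → c < n) → m ≤ n
≤-by-indices zero    n _   = z≤n
≤-by-indices (suc m) n m⇒n = m⇒n m ≤-refl

ColumnsIncreasing : Tableau → Set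
ColumnsIncreasing T = ∀ r c y → entryAt T (suc r) c ≡ just y → Σ ℕ λ x → entryAt T r c ≡ just x × x < y

Decreasing : List ℕ → Set
Decreasing = Linked (λ a b → b ≤ a)

rowCounts : ℕ → Tableau → List ℕ
rowCounts b = map (countBelow b)

rowCounts-decreasing : ∀ b T → All (Linked _<_) T → ColumnsIncreasing T → Decreasing (rowCounts b T)
rowCounts-decreasing b []            _                _  = []
rowCounts-decreasing b (r₀ ∷ [])     _                _  = [-]
rowCounts-decreasing b (r₀ ∷ r₁ ∷ T) (l₀ ∷ l₁ ∷ ls) cols =
  ≤-by-indices _ _ below ∷ rowCounts-decreasing b (r₁ ∷ T) (l₁ ∷ ls) (λ r → cols (suc r))
  where
  below : ∀ c → c < countBelow b r₁ → c < countBelow b r₀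
  below c c< with countBelow⁻ b r₁ c l₁ c<
  ... | y , y-at-c , y<b with cols 0 c y y-at-c
  ... | x , x-at-c , x<y = countBelow⁺ b r₀ c l₀ x-at-c (<-trans x<y y<b)

part-rowCounts : ∀ b T r → part (rowCounts b T) r ≡ countBelow b (row T r)
part-rowCounts b []      r       = refl
part-rowCounts b (_ ∷ T) zero    = refl
part-rowCounts b (_ ∷ T) (suc r) = part-rowCounts b T r

positiveParts : List ℕ → List ℕ
positiveParts = filter (0 <?_)

part-zeros : ∀ xs → Decreasing (0 ∷ xs) → ∀ r → part (0 ∷ xs) r ≡ 0
part-zeros xs       _         zero    = refl
part-zeros (x ∷ xs) (x≤0 ∷ d) (suc r) rewrite n≤0⇒n≡0 x≤0 = part-zeros xs d r
part-zeros []       _         (suc r) = refl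

Decreasing-tail : ∀ {x xs} → Decreasing (x ∷ xs) → Decreasing xs
Decreasing-tail [-]     = []
Decreasing-tail (_ ∷ d) = d

part-positiveParts : ∀ xs → Decreasing xs → ∀ r → part (positiveParts xs) r ≡ part xs r
part-positiveParts []           _ r = refl
part-positiveParts (zero ∷ xs)  d r = begin
  part (positiveParts xs) r ≡⟨ part-positiveParts xs (Decreasing-tail d) r ⟩
  part xs r                 ≡⟨ part-zeros xs d (suc r) ⟩
  0                         ≡⟨ part-zeros xs d r ⟨
  part (0 ∷ xs) r           ∎
  where open ≡-Reasoning
part-positiveParts (suc x ∷ xs) d zero    = refl
part-positiveParts (suc x ∷ xs) d (suc r) = part-positiveParts xs (Decreasing-tail d) r

shapeBelow : ℕ → Tableau → List ℕ
shapeBelow b T = positiveParts (rowCounts b T)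

module _ (T : Tableau) (rows : All (Linked _<_) T) (cols : ColumnsIncreasing T) where

  shapeBelow-isPartition : ∀ b → IsPartition (shapeBelow b T)
  shapeBelow-isPartition b =
    Linked.filter⁺ (0 <?_) (λ p q → ≤-trans q p) (rowCounts-decreasing b T rows cols) ,
    all-filter (0 <?_) (rowCounts b T)

  part-shapeBelow : ∀ b r → part (shapeBelow b T) r ≡ countBelow b (row T r)
  part-shapeBelow b r = trans (part-positiveParts _ (rowCounts-decreasing b T rows cols) r)
                              (part-rowCounts b T r)

SkewShape : (ℕ → ℕ → Set) → Set
SkewShape S = Σ (List ℕ) λ μ → Σ (List ℕ) λ ν →
  IsPartition μ × IsPartition ν × (∀ r → part μ r ≤ part ν r) ×
  (∀ r c → S r c ⇔ (c < part ν r × ¬ (c < part μ r)))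

skewShape⇒columnStrip : ∀ {S} → SkewShape S → (∀ r c c′ → S r c → S r c′ → c ≡ c′) → IsColumnStrip S
skewShape⇒columnStrip (μ , ν , μ-part , ν-part , μ⊆ν , S⇔ν/μ) oneInRow =
  μ , ν , μ-part , ν-part , μ⊆ν , S⇔ν/μ , oneInRow

module _ (T : Tableau) (rows : All (Linked _<_) T) (cols : ColumnsIncreasing T) (lo hi : ℕ) where

  -- ν is taken below lo ⊔ hi rather than hi so that μ ⊆ ν holds without assuming lo ≤ hi.
  entriesIn-skewShape : SkewShape (cellsWithEntriesIn T lo hi)
  entriesIn-skewShape =
    shapeBelow lo T , shapeBelow (lo ⊔ hi) T ,
    shapeBelow-isPartition T rows cols lo , shapeBelow-isPartition T rows cols (lo ⊔ hi) ,
    μ⊆ν , S⇔ν/μ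
    where
    R : ℕ → List ℕ
    R r = row T r

    sorted : ∀ r → Linked _<_ (R r)
    sorted r = row-sorted T r rows

    μ⊆ν : ∀ r → part (shapeBelow lo T) r ≤ part (shapeBelow (lo ⊔ hi) T) r
    μ⊆ν r rewrite part-shapeBelow T rows cols lo r | part-shapeBelow T rows cols (lo ⊔ hi) r =
      ≤-by-indices _ _ λ c c< → case countBelow⁻ lo (R r) c (sorted r) c< of λ where
        (e , e-at-c , e<lo) → countBelow⁺ (lo ⊔ hi) (R r) c (sorted r) e-at-c
                                 (<-≤-trans e<lo (m≤m⊔n lo hi))

    S⇔ν/μ : ∀ r c → cellsWithEntriesIn T lo hi r c ⇔
      (c < part (shapeBelow (lo ⊔ hi) T) r × ¬ (c < part (shapeBelow lo T) r))
    S⇔ν/μ r c rewrite part-shapeBelow T rows cols lo r | part-shapeBelow T rows cols (lo ⊔ hi) r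
      = mk⇔ to from
      where
      to : cellsWithEntriesIn T lo hi r c → c < countBelow (lo ⊔ hi) (R r) × ¬ (c < countBelow lo (R r))
      to (e , e-at-c , lo≤e , e<hi) =
        countBelow⁺ (lo ⊔ hi) (R r) c (sorted r) e-in-row (<-≤-trans e<hi (m≤n⊔m lo hi)) ,
        λ c< → case countBelow⁻ lo (R r) c (sorted r) c< of λ where
          (e′ , e′-in-row , e′<lo) → case trans (sym e-in-row) e′-in-row of λ where
            refl → <⇒≱ e′<lo lo≤e
        where
        e-in-row = entryAt⇒nth-row T r c e-at-c

      from : c < countBelow (lo ⊔ hi) (R r) × ¬ (c < countBelow lo (R r)) → cellsWithEntriesIn T lo hi r c
      from (c<ν , c≮μ) with countBelow⁻ (lo ⊔ hi) (R r) c (sorted r) c<ν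
      ... | e , e-at-c , e<lo⊔hi = e , trans (entryAt-row T r c) e-at-c , lo≤e , e<hi
        where
        lo≤e : lo ≤ e
        lo≤e = ≮⇒≥ λ e<lo → c≮μ (countBelow⁺ lo (R r) c (sorted r) e-at-c e<lo)
        e<hi : e < hi
        e<hi = ≰⇒> λ hi≤e → <⇒≱ e<lo⊔hi (⊔-lub lo≤e hi≤e)

module _ (T : Tableau) (rows : All (Linked _<_) T) (separates : FirstRowSeparates T) (lo hi : ℕ)
         (gap : ∀ {x} → x ∈ firstRow T → lo < x → x < hi → ⊥) where

  private
    ordered-cells-apart : ∀ r {c c′} → c < c′ →
      cellsWithEntriesIn T lo hi r c → cellsWithEntriesIn T lo hi r c′ → ⊥
    ordered-cells-apart r {c} {c′} c<c′ (e , e-at-c , lo≤e , _) (e′ , e′-at-c′ , _ , e′<hi)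
      with entryAt⇒nth-row T r c e-at-c | entryAt⇒nth-row T r c′ e′-at-c′
    ... | e-in-row | e′-in-row
      with separates r (nth-∈ _ c e-in-row) (nth-∈ _ c′ e′-in-row)
                       (nth-strictMono (row T r) (row-sorted T r rows) c<c′ e-in-row e′-in-row)
    ... | x , x∈ , e<x , x≤e′ = gap x∈ (≤-<-trans lo≤e e<x) (≤-<-trans x≤e′ e′<hi)

  entriesIn-oneCellPerRow : ∀ r c c′ →
    cellsWithEntriesIn T lo hi r c → cellsWithEntriesIn T lo hi r c′ → c ≡ c′
  entriesIn-oneCellPerRow r c c′ s s′ with <-cmp c c′
  ... | tri< c<c′ _ _ = ⊥-elim (ordered-cells-apart r c<c′ s s′)
  ... | tri≈ _ c≡c′ _ = c≡c′
  ... | tri> _ _ c′<c = ⊥-elim (ordered-cells-apart r c′<c s′ s)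

aSeq-just : ∀ n T {i a} → nth (firstRow T) i ≡ just a → aSeq n T i ≡ a
aSeq-just n T a-at-i rewrite a-at-i = refl

aSeq-≤ : ∀ n T {j k x} → Linked _<_ (firstRow T) → j ≤ k → nth (firstRow T) k ≡ just x → aSeq n T j ≤ x
aSeq-≤ n T sorted j≤k x-at-k with nth-defined-≤ (firstRow T) j≤k x-at-k
... | a , a-at-j rewrite aSeq-just n T a-at-j = nth-mono (firstRow T) sorted j≤k a-at-j x-at-k

firstRow-gap : ∀ n T {i a x} → Linked _<_ (firstRow T) → nth (firstRow T) i ≡ just a →
  x ∈ firstRow T → aSeq n T i < x → x < aSeq n T (suc i) → ⊥
firstRow-gap n T {i} sorted a-at-i x∈ a<x x<next rewrite aSeq-just n T a-at-i with ∈⇒nth x∈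
... | k , x-at-k with k ≤? i
...   | yes k≤i = <⇒≱ a<x (nth-mono (firstRow T) sorted k≤i x-at-k a-at-i)
...   | no  k≰i = <⇒≱ x<next (aSeq-≤ n T sorted (≰⇒> k≰i) x-at-k)

firstRow-sorted : ∀ T → All (Linked _<_) T → Linked _<_ (firstRow T)
firstRow-sorted []      _       = []
firstRow-sorted (_ ∷ _) (l ∷ _) = l

SYT-unique : ∀ {λ′ n T} → IsSYT λ′ n T → Unique (concat T)
SYT-unique {n = n} syt = Unique-resp-↭ (setoid ℕ) (↭⇒↭ₛ (↭-sym (IsSYT.bijective syt)))
  (Unique.map⁺ suc-injective (Unique.upTo⁺ n))

lemma5p9 : (λ′ : List ℕ) (n : ℕ) (T : Tableau) → IsSYT λ′ n T → Richardson T →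
    (i : ℕ) → i < length (firstRow T) →
    IsColumnStrip (cellsWithEntriesIn T (aSeq n T i) (aSeq n T (suc i)))
lemma5p9 λ′ n T syt richardson i i<len with nth-<-length (firstRow T) i<len
... | a , a-at-i =
  skewShape⇒columnStrip (entriesIn-skewShape T rows (IsSYT.cols-inc syt) lo hi)
    (entriesIn-oneCellPerRow T rows (richardson-separates T richardson (SYT-unique syt)) lo hi
      (firstRow-gap n T (firstRow-sorted T rows) a-at-i))
  where
  rows = IsSYT.rows-inc syt
  lo = aSeq n T i
  hi = aSeq n T (suc i)
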